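{- Let $d\ge2$ and $X\subseteq\mathbb{R}^d$. Let $h=h(y)$ be a horizontal hyperplane such that $X$ contains a point with last coordinate at least $y$. Let $X'$ be the vertical projection of $X\cap h^-$ into $h$ (i.e., $X'=\{(x_1,\dots,x_{d-1},y):x\in X,\ x_d\le y\}$). Then $h\cap\mathrm{sconv}(X)=\mathrm{sconv}(X')$, where $\mathrm{sconv}(X')$ is the $(d-1)$-dimensional stair-convex hull taken within $h$ (identified with $\mathbb{R}^{d-1}$ via the first $d-1$ coordinates).
   Context: $h(y)=\{x\in\mathbb{R}^d:x_d=y\}$, $h^-=\{x:x_d\le y\}$. Stair-path $\sigma(a,b)$ in $\mathbb{R}^k$: for $k=1$ the segment $ab$; for $k\ge2$, assuming $a_k\le b_k$ (else swap), with $a'=(a_1,\dots,a_{k-1},b_k)$, $\sigma(a,b)=aa'\cup\sigma(a',b)$, the latter recursively on the first $k-1$ coordinates. A set is stair-convex if it contains $\sigma(a,b)$ for all its points $a,b$; $\mathrm{sconv}(X)$ is the intersection of all stair-convex sets containing $X$. -}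

module Defs where

open import Level using (0ℓ)
open import Data.Nat using (ℕ; zero; suc)
open import Data.Fin using (Fin; zero; suc)
open import Data.Product using (_×_; ∃)
open import Data.Sum using (_⊎_)
open import Data.Unit using (⊤)
open import Data.Vec.Functional using (Vector; init; last)
open import Relation.Binary.Core using (Rel)
open import Relation.Binary.PropositionalEquality using (_≡_)
open import Relation.Unary using (Pred; _⊆_)

-- Stair-convexity over a totally ordered coordinate set A with order _≤_
-- (the paper's case is A = ℝ with its usual order).
module Stair {A : Set} (_≤_ : Rel A 0ℓ) where

  Pt : ℕ → Set
  Pt k = Vector A k

  snoc : {m : ℕ} → Pt m → A → Pt (suc m)
  snoc {zero}  q y _       = y
  snoc {suc m} q y zero    = q zero
  snoc {suc m} q y (suc i) = snoc (λ j → q (suc j)) y i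

  Between : A → A → A → Set
  Between u v t = (u ≤ t) × (t ≤ v)

  _≗ₚ_ : {k : ℕ} → Pt k → Pt k → Set
  p ≗ₚ q = ∀ i → p i ≡ q i

  -- Up m R a b p : p lies on the stair path from a to b in A^(m+1), where
  -- last a ≤ last b, and R is the (m)-dimensional stair-path relation:
  -- σ(a,b) = aa' ∪ σ(a',b) with a' = (a_1,…,a_m,b_{m+1}).
  Up : (m : ℕ) → (Pt m → Pt m → Pt m → Set) →
       Pt (suc m) → Pt (suc m) → Pt (suc m) → Set
  Up m R a b p =
    (last a ≤ last b) ×
    (
      ((init p ≗ₚ init a) × Between (last a) (last b) (last p))
    ⊎ -- p on σ(a', b), inside the hyperplane x_{m+1} = b_{m+1}
      ((last p ≡ last b) × R (init a) (init b) (init p)))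

  -- StairPath k a b p : the point p lies on the stair-path σ(a,b) in A^k.
  -- k = 1: the segment ab.  k ≥ 2: if a_k ≤ b_k, σ(a,b) = aa' ∪ σ(a',b);
  -- otherwise swap a and b.  (k = 0: single point, never used.)
  StairPath : (k : ℕ) → Pt k → Pt k → Pt k → Set
  StairPath zero a b p = ⊤
  StairPath (suc zero) a b p =
    Between (a zero) (b zero) (p zero) ⊎ Between (b zero) (a zero) (p zero)
  StairPath (suc (suc m)) a b p =
    Up (suc m) (StairPath (suc m)) a b p ⊎ Up (suc m) (StairPath (suc m)) b a p

  StairConvex : (k : ℕ) → Pred (Pt k) 0ℓ → Set
  StairConvex k S = ∀ a b p → S a → S b → StairPath k a b p → S p

  sconv : (k : ℕ) → Pred (Pt k) 0ℓ → Pred (Pt k) (Level.suc 0ℓ)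
  sconv k X p = ∀ (S : Pred (Pt k) 0ℓ) → StairConvex k S → X ⊆ S → S p

  projBelow : {m : ℕ} → Pred (Pt (suc m)) 0ℓ → A → Pred (Pt m) 0ℓ
  projBelow X y q = ∃ λ x → X x × (last x ≤ y) × (init x ≗ₚ q)

-- If T ⊇ X is stair-convex in ℝ^d, its slice T ∩ h is stair-convex in
-- ℝ^(d-1) and contains X': for x ∈ X below h and some z ∈ X above h, the projection of x onto
-- h lies on the vertical segment with which σ(x, z) starts. Conversely, if S ⊇ X' is
-- stair-convex in ℝ^(d-1), then {p : p_d ≤ y ⇒ (p_1, …, p_{d-1}) ∈ S} contains X and is
-- stair-convex, since a stair path is a vertical segment followed by a stair path at the
-- height of its upper end.
module Submission where

open import Defs
open import Level using (0ℓ)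
open import Data.Nat using (ℕ; zero; suc; _≤_; s≤s; z≤n)
open import Data.Fin using (zero; suc; inject₁; fromℕ)
open import Data.Product using (_×_; ∃; _,_)
open import Data.Sum using (inj₁; inj₂)
open import Data.Unit using (tt)
open import Data.Vec.Functional using (last; init)
open import Function.Bundles using (_⇔_; mk⇔)
open import Relation.Binary.Core using (Rel)
open import Relation.Binary.Structures using (IsPreorder; IsTotalOrder)
open import Relation.Binary.PropositionalEquality using (_≡_; refl; sym; trans; subst; subst₂)
open import Relation.Unary using (Pred; _⊆_)

module _ {A : Set} (_≼_ : Rel A 0ℓ) (≼-isPreorder : IsPreorder _≡_ _≼_) where

  open Stair _≼_
  open IsPreorder ≼-isPreorder using (reflexive) renaming (refl to ≼-refl; trans to ≼-trans)

  last-snoc : ∀ {m} (q : Pt m) (y : A) → last (snoc q y) ≡ y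
  last-snoc {zero}  q y = refl
  last-snoc {suc m} q y = last-snoc (λ j → q (suc j)) y

  init-snoc : ∀ {m} (q : Pt m) (y : A) → init (snoc q y) ≗ₚ q
  init-snoc {suc m} q y zero    = refl
  init-snoc {suc m} q y (suc i) = init-snoc (λ j → q (suc j)) y i

  Respects-≗ₚ : (k : ℕ) → (Pt k → Pt k → Pt k → Set) → Set
  Respects-≗ₚ k R = ∀ {a b p a′ b′ p′} → a ≗ₚ a′ → b ≗ₚ b′ → p ≗ₚ p′ → R a b p → R a′ b′ p′

  ≗ₚ-sym : ∀ {k} {p q : Pt k} → p ≗ₚ q → q ≗ₚ p
  ≗ₚ-sym p≗q i = sym (p≗q i)

  ≗ₚ-init : ∀ {m} {p q : Pt (suc m)} → p ≗ₚ q → init p ≗ₚ init q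
  ≗ₚ-init p≗q i = p≗q (inject₁ i)

  ≗ₚ-last : ∀ {m} {p q : Pt (suc m)} → p ≗ₚ q → last p ≡ last q
  ≗ₚ-last {m} p≗q = p≗q (fromℕ m)

  Up-resp-≗ₚ : ∀ {m} {R : Pt m → Pt m → Pt m → Set} →
               Respects-≗ₚ m R → Respects-≗ₚ (suc m) (Up m R)
  Up-resp-≗ₚ R-resp a≗ b≗ p≗ (a≼b , inj₁ (ip≗ia , a≼p , p≼b)) =
    subst₂ _≼_ (≗ₚ-last a≗) (≗ₚ-last b≗) a≼b ,
    inj₁ ( (λ i → trans (sym (≗ₚ-init p≗ i)) (trans (ip≗ia i) (≗ₚ-init a≗ i)))
         , subst₂ _≼_ (≗ₚ-last a≗) (≗ₚ-last p≗) a≼p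
         , subst₂ _≼_ (≗ₚ-last p≗) (≗ₚ-last b≗) p≼b )
  Up-resp-≗ₚ R-resp a≗ b≗ p≗ (a≼b , inj₂ (p≡b , r)) =
    subst₂ _≼_ (≗ₚ-last a≗) (≗ₚ-last b≗) a≼b ,
    inj₂ ( trans (sym (≗ₚ-last p≗)) (trans p≡b (≗ₚ-last b≗))
         , R-resp (≗ₚ-init a≗) (≗ₚ-init b≗) (≗ₚ-init p≗) r )

  StairPath-resp-≗ₚ : ∀ k → Respects-≗ₚ k (StairPath k)
  StairPath-resp-≗ₚ zero          a≗ b≗ p≗ _ = tt
  StairPath-resp-≗ₚ (suc zero)    a≗ b≗ p≗ (inj₁ (a≼p , p≼b)) =
    inj₁ (subst₂ _≼_ (a≗ zero) (p≗ zero) a≼p , subst₂ _≼_ (p≗ zero) (b≗ zero) p≼b)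
  StairPath-resp-≗ₚ (suc zero)    a≗ b≗ p≗ (inj₂ (b≼p , p≼a)) =
    inj₂ (subst₂ _≼_ (b≗ zero) (p≗ zero) b≼p , subst₂ _≼_ (p≗ zero) (a≗ zero) p≼a)
  StairPath-resp-≗ₚ (suc (suc m)) a≗ b≗ p≗ (inj₁ up) =
    inj₁ (Up-resp-≗ₚ (StairPath-resp-≗ₚ (suc m)) a≗ b≗ p≗ up)
  StairPath-resp-≗ₚ (suc (suc m)) a≗ b≗ p≗ (inj₂ up) =
    inj₂ (Up-resp-≗ₚ (StairPath-resp-≗ₚ (suc m)) b≗ a≗ p≗ up)

  StairPath-self : ∀ k {a p : Pt k} → p ≗ₚ a → StairPath k a a p
  StairPath-self zero          p≗a = tt
  StairPath-self (suc zero)    p≗a = inj₁ (reflexive (sym (p≗a zero)) , reflexive (p≗a zero))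
  StairPath-self (suc (suc m)) p≗a =
    inj₁ (≼-refl , inj₁ (≗ₚ-init p≗a , reflexive (sym (≗ₚ-last p≗a)) , reflexive (≗ₚ-last p≗a)))

  StairPath-vertical : ∀ {m} {a b p : Pt (suc (suc m))} →
                       last a ≼ last p → last p ≼ last b → init p ≗ₚ init a →
                       StairPath (suc (suc m)) a b p
  StairPath-vertical a≼p p≼b ip≗ia = inj₁ (≼-trans a≼p p≼b , inj₁ (ip≗ia , a≼p , p≼b))

  StairPath-snoc : ∀ {m} {a b p : Pt (suc m)} (y : A) → StairPath (suc m) a b p →
                   StairPath (suc (suc m)) (snoc a y) (snoc b y) (snoc p y)
  StairPath-snoc {a = a} {b} {p} y σ =
    inj₁ ( reflexive (trans (last-snoc a y) (sym (last-snoc b y)))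
         , inj₂ ( trans (last-snoc p y) (sym (last-snoc b y))
                , StairPath-resp-≗ₚ _ (≗ₚ-sym (init-snoc a y)) (≗ₚ-sym (init-snoc b y))
                                      (≗ₚ-sym (init-snoc p y)) σ ) )

  StairConvex-resp-≗ₚ : ∀ {k} {S : Pred (Pt k) 0ℓ} → StairConvex k S →
                        ∀ {a p} → p ≗ₚ a → S a → S p
  StairConvex-resp-≗ₚ {k} S-convex {a} {p} p≗a a∈S = S-convex a a p a∈S a∈S (StairPath-self k p≗a)

  slice : ∀ {m} → Pred (Pt (suc m)) 0ℓ → A → Pred (Pt m) 0ℓ
  slice T y q = T (snoc q y)

  slice-stairConvex : ∀ {m} {T : Pred (Pt (suc (suc m))) 0ℓ} (y : A) →
                      StairConvex (suc (suc m)) T → StairConvex (suc m) (slice T y)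
  slice-stairConvex y T-convex a b p a∈ b∈ σ = T-convex _ _ _ a∈ b∈ (StairPath-snoc y σ)

  projBelow⊆slice : ∀ {m} {X T : Pred (Pt (suc (suc m))) 0ℓ} {y : A} →
                    StairConvex (suc (suc m)) T → X ⊆ T → (∃ λ z → X z × (y ≼ last z)) →
                    projBelow X y ⊆ slice T y
  projBelow⊆slice {y = y} T-convex X⊆T (z , z∈X , y≼z) {q} (x , x∈X , x≼y , ix≗q) =
    T-convex x z (snoc q y) (X⊆T x∈X) (X⊆T z∈X)
      (StairPath-vertical {a = x} {z} {snoc q y} (subst (last x ≼_) (sym (last-snoc q y)) x≼y)
                          (subst (_≼ last z) (sym (last-snoc q y)) y≼z)
                          (λ i → trans (init-snoc q y i) (sym (ix≗q i))))

  cylinderBelow : ∀ {m} → Pred (Pt m) 0ℓ → A → Pred (Pt (suc m)) 0ℓ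
  cylinderBelow S y p = last p ≼ y → S (init p)

  cylinderBelow-stairConvex : ∀ {m} {S : Pred (Pt (suc m)) 0ℓ} (y : A) →
                              StairConvex (suc m) S → StairConvex (suc (suc m)) (cylinderBelow S y)
  cylinderBelow-stairConvex {S = S} y S-convex a b p a∈ b∈ (inj₁ up) = Up-cylinder a b p a∈ b∈ up
    where
    Up-cylinder : ∀ a b p → cylinderBelow S y a → cylinderBelow S y b →
                  Up _ (StairPath _) a b p → cylinderBelow S y p
    Up-cylinder a b p a∈ b∈ (a≼b , inj₁ (ip≗ia , a≼p , _)) p≼y =
      StairConvex-resp-≗ₚ S-convex ip≗ia (a∈ (≼-trans a≼p p≼y))
    Up-cylinder a b p a∈ b∈ (a≼b , inj₂ (p≡b , σ)) p≼y =
      S-convex (init a) (init b) (init p) (a∈ (≼-trans a≼b b≼y)) (b∈ b≼y) σ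
      where b≼y = subst (_≼ y) p≡b p≼y
  cylinderBelow-stairConvex y S-convex a b p a∈ b∈ (inj₂ up) =
    cylinderBelow-stairConvex y S-convex b a p b∈ a∈ (inj₁ up)

  sconv-slice⊆sconv-projBelow : ∀ {m} (X : Pred (Pt (suc (suc m))) 0ℓ) (y : A) (q : Pt (suc m)) →
                                sconv (suc (suc m)) X (snoc q y) → sconv (suc m) (projBelow X y) q
  sconv-slice⊆sconv-projBelow X y q q∈ S S-convex X′⊆S =
    StairConvex-resp-≗ₚ S-convex (≗ₚ-sym (init-snoc q y))
      (q∈ (cylinderBelow S y) (cylinderBelow-stairConvex y S-convex)
          (λ {x} x∈X x≼y → X′⊆S (x , x∈X , x≼y , λ _ → refl))
          (reflexive (last-snoc q y)))

  sconv-projBelow⊆sconv-slice : ∀ {m} (X : Pred (Pt (suc (suc m))) 0ℓ) (y : A) →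
                                (∃ λ z → X z × (y ≼ last z)) → (q : Pt (suc m)) →
                                sconv (suc m) (projBelow X y) q → sconv (suc (suc m)) X (snoc q y)
  sconv-projBelow⊆sconv-slice X y above q q∈ T T-convex X⊆T =
    q∈ (slice T y) (slice-stairConvex y T-convex) (projBelow⊆slice T-convex X⊆T above)

lemma5p2 : {A : Set} (_≼_ : Rel A 0ℓ) → IsTotalOrder _≡_ _≼_ →
           (m : ℕ) → 1 ≤ m →
           (X : Pred (Stair.Pt _≼_ (suc m)) 0ℓ) (y : A) →
           (∃ λ x → X x × (y ≼ last x)) →
           (q : Stair.Pt _≼_ m) →
           Stair.sconv _≼_ (suc m) X (Stair.snoc _≼_ q y) ⇔ Stair.sconv _≼_ m (Stair.projBelow _≼_ X y) q
lemma5p2 _≼_ ≼-total (suc m) (s≤s z≤n) X y above q =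
  mk⇔ (sconv-slice⊆sconv-projBelow _≼_ pre X y q)
      (sconv-projBelow⊆sconv-slice _≼_ pre X y above q)
  where pre = IsTotalOrder.isPreorder ≼-total
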